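{- Let $f:\{0,1\}^n\to\{0,1\}$ and $x\in\{0,1\}^n$ with $f(x)=0$. Let $M$ be the submatrix of $M^u_f$ with rows $P_1^{(f)}$ and columns $P_0^{(f)}|_x$, and let $M'=M^u_{\partial f(x;\cdot)}$. Then $L(M)=L(M')$ and $CC(M)=CC(M')$.
   Context: Kleene logic on $\{0,u,1\}$; order $\preceq$: $u\preceq0$, $u\preceq1$, $0,1$ incomparable, coordinatewise. $R(x)=\{y\in\{0,1\}^n: x\preceq y\}$; $\tilde h(x)=b$ if $h\equiv b$ on $R(x)$, else $u$. Prime implicants $P_1^{(h)}$: $p$ with $\tilde h(p)=1$ such that replacing any stable coordinate by $u$ yields $\tilde h=u$; prime implicates $P_0^{(h)}$ analogously with $0$. $P_0^{(f)}|_x=\{p\in P_0^{(f)}: p\preceq x\}$. Hazard-derivative: $x+uy$ has coordinate $x_i$ if $y_i=0$, $u$ if $y_i=1$; $\partial f(x;y)=0$ if $\tilde f(x+uy)=f(x)$, $1$ if $=u$. $M^u_h$: rows indexed by $P_1^{(h)}$, columns by $P_0^{(h)}$, entry $(p_1,p_0)$ = set of $d\in[n]$ with $(p_1)_d,(p_0)_d$ stable and different. A matrix whose entries are subsets of a set $Z$ defines a communication problem: Alice gets a row label, Bob a column label, and they must output an element of the corresponding entry. $CC(\cdot)$ is the minimum worst-case communication of a deterministic protocol solving it; $L(\cdot)$ is the minimum number of leaves of a protocol tree solving it. -}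

module Defs where

open import Data.Nat using (ℕ; zero; suc; _+_; _≤_)
import Data.Nat
open import Data.Bool using (Bool; true; false; if_then_else_; _∧_; not)
open import Data.Fin using (Fin)
open import Data.Vec using (Vec; []; _∷_; lookup; _[_]≔_; map)
open import Data.List as List using (List; []; _∷_; _++_)
open import Data.Product using (Σ; _×_; _,_; ∃)
open import Data.Sum using (_⊎_)
open import Relation.Binary.PropositionalEquality using (_≡_)

data Tern : Set where
  𝟘 𝕦 𝟙 : Tern

embed : Bool → Tern
embed false = 𝟘
embed true  = 𝟙

data _⪯T_ : Tern → Tern → Set where
  u⪯ : ∀ {a} → 𝕦 ⪯T a
  refl⪯ : ∀ {a} → a ⪯T a

_⪯_ : ∀ {n} → Vec Tern n → Vec Tern n → Set
p ⪯ q = ∀ i → lookup p i ⪯T lookup q i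

_⪯Tᵇ_ : Tern → Bool → Bool
𝕦 ⪯Tᵇ _ = true
𝟘 ⪯Tᵇ false = true
𝟘 ⪯Tᵇ true = false
𝟙 ⪯Tᵇ true = true
𝟙 ⪯Tᵇ false = false

compatible : ∀ {n} → Vec Tern n → Vec Bool n → Bool
compatible [] [] = true
compatible (a ∷ x) (b ∷ y) = (a ⪯Tᵇ b) ∧ compatible x y

allBool : (n : ℕ) → List (Vec Bool n)
allBool zero = [] ∷ []
allBool (suc n) = List.map (false ∷_) (allBool n) ++ List.map (true ∷_) (allBool n)

R : ∀ {n} → Vec Tern n → List (Vec Bool n)
R {n} x = List.filterᵇ (compatible x) (allBool n)

allᵇ : ∀ {A : Set} → (A → Bool) → List A → Bool
allᵇ p [] = true
allᵇ p (a ∷ as) = p a ∧ allᵇ p as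

tilde : ∀ {n} → (Vec Bool n → Bool) → Vec Tern n → Tern
tilde h x =
  if allᵇ h (R x) then 𝟙
  else if allᵇ (λ y → not (h y)) (R x) then 𝟘
  else 𝕦

Stable : Tern → Set
Stable a = (a ≡ 𝟘) ⊎ (a ≡ 𝟙)

-- prime implicants (b = 𝟙) and prime implicates (b = 𝟘)
IsPrime : ∀ {n} → Tern → (Vec Bool n → Bool) → Vec Tern n → Set
IsPrime b h p = (tilde h p ≡ b) × (∀ i → Stable (lookup p i) → tilde h (p [ i ]≔ 𝕦) ≡ 𝕦)

P₁ : ∀ {n} → (Vec Bool n → Bool) → Set
P₁ {n} h = Σ (Vec Tern n) (IsPrime 𝟙 h)

P₀ : ∀ {n} → (Vec Bool n → Bool) → Set
P₀ {n} h = Σ (Vec Tern n) (IsPrime 𝟘 h)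

P₀∣ : ∀ {n} → (Vec Bool n → Bool) → Vec Bool n → Set
P₀∣ {n} h x = Σ (Vec Tern n) (λ p → IsPrime 𝟘 h p × (p ⪯ map embed x))

data Conflict : Tern → Tern → Set where
  c01 : Conflict 𝟘 𝟙
  c10 : Conflict 𝟙 𝟘

_+u_ : ∀ {n} → Vec Bool n → Vec Bool n → Vec Tern n
[] +u [] = []
(a ∷ x) +u (false ∷ y) = embed a ∷ (x +u y)
(a ∷ x) +u (true ∷ y) = 𝕦 ∷ (x +u y)

isU : Tern → Bool
isU 𝕦 = true
isU _ = false

-- ∂f(x;y) = 0 if f̃(x+uy) = f(x), 1 if f̃(x+uy) = u
-- (f̃(x+uy) ∈ {f(x), u} always, since x ∈ R(x+uy))
∂ : ∀ {n} → (Vec Bool n → Bool) → Vec Bool n → Vec Bool n → Bool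
∂ f x y = isU (tilde f (x +u y))

record CommProblem : Set₁ where
  field
    Row : Set
    Col : Set
    Out : Set
    Entry : Row → Col → Out → Set

data Protocol (A B Z : Set) : Set where
  leaf  : Z → Protocol A B Z
  alice : (A → Bool) → Protocol A B Z → Protocol A B Z → Protocol A B Z
  bob   : (B → Bool) → Protocol A B Z → Protocol A B Z → Protocol A B Z

module _ {A B Z : Set} where
  run : Protocol A B Z → A → B → Z
  run (leaf z) a b = z
  run (alice g l r) a b = if g a then run r a b else run l a b
  run (bob g l r) a b = if g b then run r a b else run l a b

  depth : Protocol A B Z → ℕ
  depth (leaf _) = 0
  depth (alice _ l r) = suc (depth l Data.Nat.⊔ depth r)
  depth (bob _ l r) = suc (depth l Data.Nat.⊔ depth r)

  leaves : Protocol A B Z → ℕ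
  leaves (leaf _) = 1
  leaves (alice _ l r) = leaves l + leaves r
  leaves (bob _ l r) = leaves l + leaves r

module _ (M : CommProblem) where
  open CommProblem M

  Solves : Protocol Row Col Out → Set
  Solves π = ∀ a b → Entry a b (run π a b)

  IsCC : ℕ → Set
  IsCC k = (Σ (Protocol Row Col Out) λ π → Solves π × depth π ≡ k)
         × (∀ π → Solves π → k ≤ depth π)

  IsL : ℕ → Set
  IsL k = (Σ (Protocol Row Col Out) λ π → Solves π × leaves π ≡ k)
        × (∀ π → Solves π → k ≤ leaves π)

Mu : ∀ {n} → (Vec Bool n → Bool) → CommProblem
Mu {n} h = record
  { Row = P₁ h ; Col = P₀ h ; Out = Fin n
  ; Entry = λ p₁ p₀ d → Conflict (lookup (Data.Product.proj₁ p₁) d) (lookup (Data.Product.proj₁ p₀) d) }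

Mx : ∀ {n} → (Vec Bool n → Bool) → Vec Bool n → CommProblem
Mx {n} f x = record
  { Row = P₁ f ; Col = P₀∣ f x ; Out = Fin n
  ; Entry = λ p₁ p₀ d → Conflict (lookup (Data.Product.proj₁ p₁) d) (lookup (Data.Product.proj₁ p₀) d) }

{-# OPTIONS --safe #-}
module Submission where

-- Since f x = 0, ∂f(x;y) = 1 exactly when f takes the value 1 on R(x + u y), i.e. at some point that
-- differs from x only inside y. Reading y as a set of flipped coordinates, prime implicants and
-- implicates translate in both directions: an implicate p ⪯ x of f becomes the implicate "flip
-- nothing where p is stable"; an implicant p of f becomes the implicant "flip wherever p disagrees
-- with x", shrunk to a prime one. Conversely an implicate q of ∂f(x;·) gives the implicate
-- x + u·(q completed by 1s) of f, and an implicant q gives a point z with f z = 1 in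
-- R(x + u·(q completed by 0s)), whose prime implicant below z is taken. Every coordinate where the
-- translated implicant and implicate conflict is already a conflict of the original pair, so a
-- protocol for either matrix turns into a protocol of the same shape for the other, with the same
-- number of leaves and the same depth.

open import Defs
open import Data.Nat using (ℕ; suc; _≤_; _+_; _⊔_)
open import Data.Bool using (Bool; true; false; not; _xor_; if_then_else_; T)
open import Data.Bool.Properties using (T-∧; not-injective)
open import Data.Fin using (Fin; zero; suc; _≟_)
open import Data.Vec using (Vec; []; _∷_; lookup; _[_]≔_; map; zipWith; replicate)
open import Data.Vec.Properties
  using (lookup∘update; lookup∘update′; lookup-map; lookup-zipWith; lookup-replicate)
open import Data.List as List using (List; []; _∷_; allFin)
open import Data.List.Membership.Propositional using (_∈_)
open import Data.List.Membership.Propositional.Properties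
  using (∈-filter⁺; ∈-filter⁻; ∈-map⁺; ∈-++⁺ˡ; ∈-++⁺ʳ; ∈-allFin)
open import Data.List.Relation.Unary.Any using (here; there)
open import Data.Product using (Σ; ∃; _×_; _,_; proj₁; proj₂)
open import Data.Sum using (_⊎_; inj₁; inj₂)
open import Data.Empty using (⊥-elim)
open import Function using (id; _∘_)
open import Function.Bundles using (_⇔_; mk⇔; Equivalence)
open import Relation.Nullary using (¬_; yes; no)
open import Relation.Nullary.Decidable using (T?)
open import Relation.Binary.PropositionalEquality
  using (_≡_; _≢_; refl; sym; trans; cong; cong₂; subst; subst₂)

private
  variable
    n : ℕ
    a a′ b : Tern
    p : Vec Tern n
    y : Vec Bool n
    h : Vec Bool n → Bool

⪯T-trans : ∀ {c} → a ⪯T a′ → a′ ⪯T c → a ⪯T c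
⪯T-trans u⪯ _ = u⪯
⪯T-trans refl⪯ a′⪯c = a′⪯c

⪯T-cases : a ⪯T b → a ≡ 𝕦 ⊎ a ≡ b
⪯T-cases u⪯ = inj₁ refl
⪯T-cases refl⪯ = inj₂ refl

⪯T-𝕦 : a ⪯T 𝕦 → a ≡ 𝕦
⪯T-𝕦 u⪯ = refl
⪯T-𝕦 refl⪯ = refl

⪯T-embed : ∀ {u v} → embed u ⪯T embed v → u ≡ v
⪯T-embed {false} {false} refl⪯ = refl
⪯T-embed {true} {true} refl⪯ = refl
⪯T-embed {false} {true} ()
⪯T-embed {true} {false} ()

¬Stable-𝕦 : ¬ Stable 𝕦
¬Stable-𝕦 (inj₁ ())
¬Stable-𝕦 (inj₂ ())

Conflict-⪯ˡ : a ⪯T a′ → Conflict a b → Conflict a′ b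
Conflict-⪯ˡ refl⪯ conflict = conflict

Conflict-embed⇒≢ : ∀ {u v} → Conflict (embed u) (embed v) → u ≢ v
Conflict-embed⇒≢ {false} {false} ()
Conflict-embed⇒≢ {true} {true} ()
Conflict-embed⇒≢ {false} {true} _ ()
Conflict-embed⇒≢ {true} {false} _ ()

⪯-refl : ∀ (p : Vec Tern n) → p ⪯ p
⪯-refl _ i = refl⪯

⪯-trans : ∀ (r q p : Vec Tern n) → r ⪯ q → q ⪯ p → r ⪯ p
⪯-trans _ _ _ r⪯q q⪯p i = ⪯T-trans (r⪯q i) (q⪯p i)

[]≔𝕦-pointwise : ∀ (p : Vec Tern n) i (P : Fin n → Tern → Set) → (∀ j → P j 𝕦) →
                 (∀ j → j ≢ i → P j (lookup p j)) → ∀ j → P j (lookup (p [ i ]≔ 𝕦) j)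
[]≔𝕦-pointwise p i P P𝕦 Pp j with j ≟ i
... | yes refl rewrite lookup∘update i p 𝕦 = P𝕦 i
... | no j≢i rewrite lookup∘update′ j≢i p 𝕦 = Pp j j≢i

[]≔𝕦-⪯ : ∀ (p : Vec Tern n) i → (p [ i ]≔ 𝕦) ⪯ p
[]≔𝕦-⪯ p i = []≔𝕦-pointwise p i (λ j t → t ⪯T lookup p j) (λ _ → u⪯) (λ _ _ → refl⪯)

[]≔𝕦-mono : ∀ (q p : Vec Tern n) i → q ⪯ p → (q [ i ]≔ 𝕦) ⪯ (p [ i ]≔ 𝕦)
[]≔𝕦-mono q p i q⪯p =
  []≔𝕦-pointwise q i (λ j t → t ⪯T lookup (p [ i ]≔ 𝕦) j) (λ _ → u⪯)
    (λ j j≢i → subst (lookup q j ⪯T_) (sym (lookup∘update′ j≢i p 𝕦)) (q⪯p j))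

-- p ≼ y means y ∈ R(p); it is a record so that p and y can be inferred from it.
infix 4 _≼_
record _≼_ (p : Vec Tern n) (y : Vec Bool n) : Set where
  constructor pointwise
  field at : ∀ i → lookup p i ⪯T embed (lookup y i)
open _≼_

≼-antimono : ∀ (q p : Vec Tern n) → q ⪯ p → p ≼ y → q ≼ y
≼-antimono _ _ q⪯p p≼y = pointwise λ i → ⪯T-trans (q⪯p i) (at p≼y i)

≼-[]≔𝕦 : ∀ (p : Vec Tern n) y i →
         (∀ j → j ≢ i → lookup p j ⪯T embed (lookup y j)) → (p [ i ]≔ 𝕦) ≼ y
≼-[]≔𝕦 p y i p≼y =
  pointwise ([]≔𝕦-pointwise p i (λ j t → t ⪯T embed (lookup y j)) (λ _ → u⪯) p≼y)

≼-[]≔𝕦⁻ : ∀ (p : Vec Tern n) y {i j} →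
          (p [ i ]≔ 𝕦) ≼ y → j ≢ i → lookup p j ⪯T embed (lookup y j)
≼-[]≔𝕦⁻ p y {j = j} p≼y j≢i =
  subst (_⪯T embed (lookup y j)) (lookup∘update′ j≢i p 𝕦) (at p≼y j)

⪯-embed⇒≼ : ∀ (p : Vec Tern n) x → p ⪯ map embed x → p ≼ x
⪯-embed⇒≼ p x p⪯x = pointwise λ i → subst (lookup p i ⪯T_) (lookup-map i embed x) (p⪯x i)

embed-≼⇒≡ : ∀ (z y : Vec Bool n) → map embed z ≼ y → y ≡ z
embed-≼⇒≡ [] [] _ = refl
embed-≼⇒≡ (u ∷ z) (v ∷ y) z≼y =
  cong₂ _∷_ (sym (⪯T-embed (at z≼y zero))) (embed-≼⇒≡ z y (pointwise (at z≼y ∘ suc)))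

⪯Tᵇ⇒⪯T : ∀ a u → T (a ⪯Tᵇ u) → a ⪯T embed u
⪯Tᵇ⇒⪯T 𝟘 false _ = refl⪯
⪯Tᵇ⇒⪯T 𝟙 true _ = refl⪯
⪯Tᵇ⇒⪯T 𝕦 u _ = u⪯

⪯T⇒⪯Tᵇ : ∀ {u} → a ⪯T embed u → T (a ⪯Tᵇ u)
⪯T⇒⪯Tᵇ u⪯ = _
⪯T⇒⪯Tᵇ {u = false} refl⪯ = _
⪯T⇒⪯Tᵇ {u = true} refl⪯ = _

compatible⇒≼ : ∀ (p : Vec Tern n) y → T (compatible p y) → p ≼ y
compatible⇒≼ [] [] _ = pointwise λ ()
compatible⇒≼ (a ∷ p) (u ∷ y) c = pointwise λ
  { zero → ⪯Tᵇ⇒⪯T a u (proj₁ (Equivalence.to T-∧ c))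
  ; (suc i) → at (compatible⇒≼ p y (proj₂ (Equivalence.to T-∧ c))) i }

≼⇒compatible : ∀ (p : Vec Tern n) y → p ≼ y → T (compatible p y)
≼⇒compatible [] [] _ = _
≼⇒compatible (a ∷ p) (u ∷ y) p≼y =
  Equivalence.from T-∧ (⪯T⇒⪯Tᵇ (at p≼y zero) , ≼⇒compatible p y (pointwise (at p≼y ∘ suc)))

∈-allBool : ∀ (y : Vec Bool n) → y ∈ allBool n
∈-allBool [] = here refl
∈-allBool {suc n} (false ∷ y) = ∈-++⁺ˡ (∈-map⁺ (false ∷_) (∈-allBool y))
∈-allBool {suc n} (true ∷ y) =
  ∈-++⁺ʳ (List.map (false ∷_) (allBool n)) (∈-map⁺ (true ∷_) (∈-allBool y))

∈R⇒≼ : ∀ p → y ∈ R p → p ≼ y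
∈R⇒≼ {y = y} p y∈R =
  compatible⇒≼ p y (proj₂ (∈-filter⁻ (T? ∘ compatible p) {xs = allBool _} y∈R))

≼⇒∈R : ∀ p → p ≼ y → y ∈ R p
≼⇒∈R {y = y} p p≼y = ∈-filter⁺ (T? ∘ compatible p) (∈-allBool y) (≼⇒compatible p y p≼y)

allᵇ-true⁻ : ∀ {A : Set} {P : A → Bool} {xs u} → allᵇ P xs ≡ true → u ∈ xs → P u ≡ true
allᵇ-true⁻ {P = P} {u ∷ _} all (here refl) with P u
... | true = refl
allᵇ-true⁻ {P = P} {v ∷ _} all (there u∈xs) with P v
... | true = allᵇ-true⁻ all u∈xs

allᵇ-false⁻ : ∀ {A : Set} {P : A → Bool} xs → allᵇ P xs ≡ false → ∃ λ u → u ∈ xs × P u ≡ false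
allᵇ-false⁻ {P = P} (u ∷ xs) all with P u in Pu
... | true = let v , v∈xs , Pv = allᵇ-false⁻ xs all in v , there v∈xs , Pv
... | false = u , here refl , Pu

fill : Tern → Bool → Bool
fill 𝟘 _ = false
fill 𝟙 _ = true
fill 𝕦 u = u

complete : Vec Tern n → Vec Bool n → Vec Bool n
complete = zipWith fill

⪯T-fill : ∀ a u → a ⪯T embed (fill a u)
⪯T-fill 𝟘 _ = refl⪯
⪯T-fill 𝟙 _ = refl⪯
⪯T-fill 𝕦 _ = u⪯

≼-complete : ∀ (p : Vec Tern n) x → p ≼ complete p x
≼-complete p x = pointwise λ i →
  subst (lookup p i ⪯T_) (cong embed (sym (lookup-zipWith fill i p x))) (⪯T-fill (lookup p i) (lookup x i))

lookup-complete-replicate : ∀ (q : Vec Tern n) u i →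
                            lookup (complete q (replicate n u)) i ≡ fill (lookup q i) u
lookup-complete-replicate {n} q u i =
  trans (lookup-zipWith fill i q (replicate n u)) (cong (fill (lookup q i)) (lookup-replicate i u))

lookup-+u : ∀ (x y : Vec Bool n) i →
            lookup (x +u y) i ≡ (if lookup y i then 𝕦 else embed (lookup x i))
lookup-+u (u ∷ x) (false ∷ y) zero = refl
lookup-+u (u ∷ x) (true ∷ y) zero = refl
lookup-+u (u ∷ x) (false ∷ y) (suc i) = lookup-+u x y i
lookup-+u (u ∷ x) (true ∷ y) (suc i) = lookup-+u x y i

+u-≼⁺ : ∀ (x y z : Vec Bool n) →
        (∀ i → lookup y i ≡ false → lookup z i ≡ lookup x i) → x +u y ≼ z
+u-≼⁺ x y z agree = pointwise at′
  where
  at′ : ∀ i → lookup (x +u y) i ⪯T embed (lookup z i)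
  at′ i rewrite lookup-+u x y i with lookup y i in yᵢ
  ... | true = u⪯
  ... | false rewrite agree i yᵢ = refl⪯

+u-≼⁻ : ∀ (x y z : Vec Bool n) →
        x +u y ≼ z → ∀ i → lookup y i ≡ false → lookup z i ≡ lookup x i
+u-≼⁻ x y z x+uy≼z i yᵢ = sym (⪯T-embed (subst (_⪯T embed (lookup z i)) lookup≡ (at x+uy≼z i)))
  where
  lookup≡ : lookup (x +u y) i ≡ embed (lookup x i)
  lookup≡ rewrite lookup-+u x y i | yᵢ = refl

+u-≼-self : ∀ (x y : Vec Bool n) → x +u y ≼ x
+u-≼-self x y = +u-≼⁺ x y x λ _ _ → refl

+u-⪯ : ∀ (x y : Vec Bool n) → (x +u y) ⪯ map embed x
+u-⪯ x y i rewrite lookup-+u x y i | lookup-map i embed x with lookup y i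
... | true = u⪯
... | false = refl⪯

xor≡false⇒≡ : ∀ {u v} → u xor v ≡ false → u ≡ v
xor≡false⇒≡ {false} {false} _ = refl
xor≡false⇒≡ {true} {true} _ = refl

+u-xor-≼ : ∀ (x z : Vec Bool n) → x +u zipWith _xor_ z x ≼ z
+u-xor-≼ x z = +u-≼⁺ x _ z λ i e → xor≡false⇒≡ (trans (sym (lookup-zipWith _xor_ i z x)) e)

-- The Kleene extension

ConstantOn : (Vec Bool n → Bool) → Bool → Vec Tern n → Set
ConstantOn h u p = ∀ y → p ≼ y → h y ≡ u

Attains : (Vec Bool n → Bool) → Bool → Vec Tern n → Set
Attains h u p = ∃ λ y → p ≼ y × h y ≡ u

constant⇒attains : ∀ {u} p → ConstantOn h u p → Attains h u p
constant⇒attains p c = let y = complete p (replicate _ false) in y , ≼-complete p _ , c y (≼-complete p _)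

attains-constant : ∀ {u v} → Attains h u p → ConstantOn h v p → u ≡ v
attains-constant (y , p≼y , hy≡u) c = trans (sym hy≡u) (c y p≼y)

data TildeSpec (h : Vec Bool n → Bool) (p : Vec Tern n) : Tern → Set where
  constant₀ : ConstantOn h false p → TildeSpec h p 𝟘
  constant₁ : ConstantOn h true p → TildeSpec h p 𝟙
  mixed : Attains h true p → Attains h false p → TildeSpec h p 𝕦

tilde-spec : ∀ (h : Vec Bool n → Bool) p → TildeSpec h p (tilde h p)
tilde-spec h p with allᵇ h (R p) in all₁ | allᵇ (λ y → not (h y)) (R p) in all₀
... | true | _ = constant₁ λ y p≼y → allᵇ-true⁻ all₁ (≼⇒∈R p p≼y)
... | false | true = constant₀ λ y p≼y → not-injective (allᵇ-true⁻ all₀ (≼⇒∈R p p≼y))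
... | false | false =
  let y₁ , y₁∈R , hy₁ = allᵇ-false⁻ (R p) all₀
      y₀ , y₀∈R , hy₀ = allᵇ-false⁻ (R p) all₁
  in mixed (y₁ , ∈R⇒≼ p y₁∈R , not-injective hy₁) (y₀ , ∈R⇒≼ p y₀∈R , hy₀)

TildeSpec-embed⁻ : ∀ {t u} → TildeSpec h p t → t ≡ embed u → ConstantOn h u p
TildeSpec-embed⁻ {u = false} (constant₀ c) refl = c
TildeSpec-embed⁻ {u = true} (constant₁ c) refl = c
TildeSpec-embed⁻ {u = true} (constant₀ c) ()
TildeSpec-embed⁻ {u = false} (constant₁ c) ()
TildeSpec-embed⁻ {u = false} (mixed _ _) ()
TildeSpec-embed⁻ {u = true} (mixed _ _) ()

TildeSpec-embed⁺ : ∀ {t u} → TildeSpec h p t → ConstantOn h u p → t ≡ embed u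
TildeSpec-embed⁺ {p = p} (constant₀ c) c′ = cong embed (attains-constant (constant⇒attains p c) c′)
TildeSpec-embed⁺ {p = p} (constant₁ c) c′ = cong embed (attains-constant (constant⇒attains p c) c′)
TildeSpec-embed⁺ (mixed a₁ a₀) c′ with trans (attains-constant a₁ c′) (sym (attains-constant a₀ c′))
... | ()

tilde-embed⁻ : ∀ (h : Vec Bool n → Bool) p u → tilde h p ≡ embed u → ConstantOn h u p
tilde-embed⁻ h p u = TildeSpec-embed⁻ (tilde-spec h p)

tilde-embed⁺ : ∀ (h : Vec Bool n → Bool) p u → ConstantOn h u p → tilde h p ≡ embed u
tilde-embed⁺ h p u = TildeSpec-embed⁺ (tilde-spec h p)

tilde-𝕦⁻ : ∀ (h : Vec Bool n → Bool) p → tilde h p ≡ 𝕦 → Attains h true p × Attains h false p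
tilde-𝕦⁻ h p _ with tilde h p | tilde-spec h p
... | .𝕦 | mixed a₁ a₀ = a₁ , a₀

tilde-𝕦⁺ : ∀ (h : Vec Bool n → Bool) p → Attains h true p → Attains h false p → tilde h p ≡ 𝕦
tilde-𝕦⁺ h p a₁ a₀ with tilde h p | tilde-spec h p
... | .𝟘 | constant₀ c with attains-constant a₁ c
...   | ()
tilde-𝕦⁺ h p a₁ a₀ | .𝟙 | constant₁ c with attains-constant a₀ c
...   | ()
tilde-𝕦⁺ h p a₁ a₀ | .𝕦 | mixed _ _ = refl

tilde-mono : ∀ (h : Vec Bool n → Bool) q p → q ⪯ p → tilde h q ⪯T tilde h p
tilde-mono h q p q⪯p with tilde h q | tilde-spec h q
... | .𝟘 | constant₀ c =
  subst (𝟘 ⪯T_) (sym (tilde-embed⁺ h p false λ y p≼y → c y (≼-antimono q p q⪯p p≼y))) refl⪯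
... | .𝟙 | constant₁ c =
  subst (𝟙 ⪯T_) (sym (tilde-embed⁺ h p true λ y p≼y → c y (≼-antimono q p q⪯p p≼y))) refl⪯
... | .𝕦 | mixed _ _ = u⪯

tilde-𝕦-antimono : ∀ (h : Vec Bool n → Bool) q p → q ⪯ p → tilde h p ≡ 𝕦 → tilde h q ≡ 𝕦
tilde-𝕦-antimono h q p q⪯p tp≡𝕦 = ⪯T-𝕦 (subst (tilde h q ⪯T_) tp≡𝕦 (tilde-mono h q p q⪯p))

¬Stable-⪯[]≔𝕦 : ∀ (q p : Vec Tern n) i → q ⪯ (p [ i ]≔ 𝕦) → ¬ Stable (lookup q i)
¬Stable-⪯[]≔𝕦 q p i q⪯p′ st =
  ¬Stable-𝕦 (subst Stable (⪯T-𝕦 (subst (lookup q i ⪯T_) (lookup∘update i p 𝕦) (q⪯p′ i))) st)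

record PrimeBelow (b : Tern) (h : Vec Bool n → Bool) (p : Vec Tern n) : Set where
  field
    prime : Vec Tern n
    prime⪯ : prime ⪯ p
    isPrime : IsPrime b h prime

module _ (h : Vec Bool n → Bool) (u : Bool) where

  PrimeAt : List (Fin n) → Vec Tern n → Set
  PrimeAt is q = ∀ {i} → i ∈ is → Stable (lookup q i) → tilde h (q [ i ]≔ 𝕦) ≡ 𝕦

  -- Greedily drop each coordinate in turn if that keeps the value. A coordinate that could not be
  -- dropped cannot be dropped later either, since undefinedness is inherited by smaller vectors.
  shrink : ∀ is p → tilde h p ≡ embed u →
           Σ (Vec Tern n) λ q → q ⪯ p × tilde h q ≡ embed u × PrimeAt is q
  shrink [] p tp = p , ⪯-refl p , tp , λ ()
  shrink (i ∷ is) p tp with ⪯T-cases (tilde-mono h (p [ i ]≔ 𝕦) p ([]≔𝕦-⪯ p i))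
  ... | inj₁ tp′≡𝕦 with shrink is p tp
  ...   | q , q⪯p , tq , primeAt = q , q⪯p , tq , λ
          { (here refl) _ →
              tilde-𝕦-antimono h (q [ i ]≔ 𝕦) (p [ i ]≔ 𝕦) ([]≔𝕦-mono q p i q⪯p) tp′≡𝕦
          ; (there i∈is) → primeAt i∈is }
  shrink (i ∷ is) p tp | inj₂ tp′≡tp with shrink is (p [ i ]≔ 𝕦) (trans tp′≡tp tp)
  ...   | q , q⪯p′ , tq , primeAt = q , ⪯-trans q (p [ i ]≔ 𝕦) p q⪯p′ ([]≔𝕦-⪯ p i) , tq , λ
          { (here refl) st → ⊥-elim (¬Stable-⪯[]≔𝕦 q p i q⪯p′ st)
          ; (there i∈is) → primeAt i∈is }

  prime-below : ∀ p → tilde h p ≡ embed u → PrimeBelow (embed u) h p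
  prime-below p tp with shrink (allFin n) p tp
  ... | q , q⪯p , tq , primeAt = record
    { prime = q ; prime⪯ = q⪯p ; isPrime = tq , λ i → primeAt (∈-allFin i) }

noFlip : Tern → Tern
noFlip 𝟘 = 𝟘
noFlip 𝟙 = 𝟘
noFlip 𝕦 = 𝕦

mustFlip : Tern → Bool → Tern
mustFlip 𝟘 true = 𝟙
mustFlip 𝟙 false = 𝟙
mustFlip 𝟘 false = 𝕦
mustFlip 𝟙 true = 𝕦
mustFlip 𝕦 _ = 𝕦

unflipped : Tern → Bool → Tern
unflipped a u = if fill a true then 𝕦 else embed u

noFlip-stable : Stable (noFlip a) → Stable a
noFlip-stable {𝟘} _ = inj₁ refl
noFlip-stable {𝟙} _ = inj₂ refl
noFlip-stable {𝕦} st = ⊥-elim (¬Stable-𝕦 st)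

noFlip-⪯𝟘 : ∀ a → noFlip a ⪯T 𝟘
noFlip-⪯𝟘 𝟘 = refl⪯
noFlip-⪯𝟘 𝟙 = refl⪯
noFlip-⪯𝟘 𝕦 = u⪯

⪯T-noFlip : ∀ {u v w} → a ⪯T embed u → noFlip a ⪯T embed v → (v ≡ false → w ≡ u) → a ⪯T embed w
⪯T-noFlip u⪯ _ _ = u⪯
⪯T-noFlip {u = u} {false} refl⪯ _ w≡u rewrite w≡u refl = refl⪯
⪯T-noFlip {u = false} {true} refl⪯ () _
⪯T-noFlip {u = true} {true} refl⪯ () _

noFlip-⪯-xor : ∀ {u w} → a ⪯T embed u → a ⪯T embed w → noFlip a ⪯T embed (w xor u)
noFlip-⪯-xor u⪯ _ = u⪯
noFlip-⪯-xor {u = false} {false} refl⪯ refl⪯ = refl⪯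
noFlip-⪯-xor {u = true} {true} refl⪯ refl⪯ = refl⪯
noFlip-⪯-xor {u = false} {true} refl⪯ ()
noFlip-⪯-xor {u = true} {false} refl⪯ ()

fill-mustFlip : ∀ a {u v} → mustFlip a u ⪯T embed v → v ≡ false → fill a u ≡ u
fill-mustFlip 𝟘 {false} _ _ = refl
fill-mustFlip 𝟘 {true} () refl
fill-mustFlip 𝟙 {false} () refl
fill-mustFlip 𝟙 {true} _ _ = refl
fill-mustFlip 𝕦 _ _ = refl

conflict-mustFlip : ∀ {u c} → Conflict (mustFlip a u) (noFlip c) → c ⪯T embed u → Conflict a c
conflict-mustFlip {𝟘} {true} {𝟙} _ _ = c01
conflict-mustFlip {𝟙} {false} {𝟘} _ _ = c10
conflict-mustFlip {𝟘} {true} {𝟘} _ ()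
conflict-mustFlip {𝟙} {false} {𝟙} _ ()
conflict-mustFlip {𝟘} {true} {𝕦} () _
conflict-mustFlip {𝟙} {false} {𝕦} () _
conflict-mustFlip {𝟘} {false} () _
conflict-mustFlip {𝟙} {true} () _
conflict-mustFlip {𝕦} () _

unflipped-stable : ∀ {u} → Stable (unflipped a u) → a ≡ 𝟘
unflipped-stable {𝟘} _ = refl
unflipped-stable {𝟙} st = ⊥-elim (¬Stable-𝕦 st)
unflipped-stable {𝕦} st = ⊥-elim (¬Stable-𝕦 st)

unflipped-⪯ : ∀ a {u v w} → a ⪯T embed v → (v ≡ false → w ≡ u) → unflipped a u ⪯T embed w
unflipped-⪯ 𝟘 {v = false} _ w≡u rewrite w≡u refl = refl⪯
unflipped-⪯ 𝟘 {v = true} () _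
unflipped-⪯ 𝟙 _ _ = u⪯
unflipped-⪯ 𝕦 _ _ = u⪯

conflict-unflipped : ∀ a b {u w} → Conflict (embed w) (unflipped b u) →
                     (fill a false ≡ false → w ≡ u) → Conflict a b
conflict-unflipped 𝟙 𝟘 _ _ = c10
conflict-unflipped 𝟘 𝟘 conflict w≡u = ⊥-elim (Conflict-embed⇒≢ conflict (w≡u refl))
conflict-unflipped 𝕦 𝟘 conflict w≡u = ⊥-elim (Conflict-embed⇒≢ conflict (w≡u refl))
conflict-unflipped _ 𝟙 {w = false} ()
conflict-unflipped _ 𝟙 {w = true} ()
conflict-unflipped _ 𝕦 {w = false} ()
conflict-unflipped _ 𝕦 {w = true} ()

-- Reductions between communication problems

record Reduction (M N : CommProblem) : Set where
  private
    module M = CommProblem M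
    module N = CommProblem N
  field
    row : M.Row → N.Row
    col : M.Col → N.Col
    out : N.Out → M.Out
    sound : ∀ a b z → N.Entry (row a) (col b) z → M.Entry a b (out z)

module _ {M N : CommProblem} (r : Reduction M N) where
  private
    module M = CommProblem M
    module N = CommProblem N
  open Reduction r

  pull : Protocol N.Row N.Col N.Out → Protocol M.Row M.Col M.Out
  pull (leaf z) = leaf (out z)
  pull (alice g l r) = alice (g ∘ row) (pull l) (pull r)
  pull (bob g l r) = bob (g ∘ col) (pull l) (pull r)

  run-pull : ∀ π a b → run (pull π) a b ≡ out (run π (row a) (col b))
  run-pull (leaf z) a b = refl
  run-pull (alice g l r) a b with g (row a)
  ... | true = run-pull r a b
  ... | false = run-pull l a b
  run-pull (bob g l r) a b with g (col b)
  ... | true = run-pull r a b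
  ... | false = run-pull l a b

  solves-pull : ∀ π → Solves N π → Solves M (pull π)
  solves-pull π solves a b =
    subst (M.Entry a b) (sym (run-pull π a b)) (sound a b _ (solves (row a) (col b)))

  leaves-pull : ∀ π → leaves (pull π) ≡ leaves π
  leaves-pull (leaf z) = refl
  leaves-pull (alice g l r) = cong₂ _+_ (leaves-pull l) (leaves-pull r)
  leaves-pull (bob g l r) = cong₂ _+_ (leaves-pull l) (leaves-pull r)

  depth-pull : ∀ π → depth (pull π) ≡ depth π
  depth-pull (leaf z) = refl
  depth-pull (alice g l r) = cong suc (cong₂ _⊔_ (depth-pull l) (depth-pull r))
  depth-pull (bob g l r) = cong suc (cong₂ _⊔_ (depth-pull l) (depth-pull r))

Cost : Set₁
Cost = ∀ {A B Z : Set} → Protocol A B Z → ℕ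

-- IsL M = Optimal M leaves and IsCC M = Optimal M depth, definitionally.
Optimal : CommProblem → Cost → ℕ → Set
Optimal M cost k = (Σ (Protocol Row Col Out) λ π → Solves M π × cost π ≡ k)
                 × (∀ π → Solves M π → k ≤ cost π)
  where open CommProblem M

PullInvariant : Cost → Set₁
PullInvariant cost = ∀ {M N} (r : Reduction M N) π → cost (pull r π) ≡ cost π

module _ (cost : Cost) (invariant : PullInvariant cost) where

  Optimal-transfer : ∀ {M N} → Reduction M N → Reduction N M → ∀ {k} →
                     Optimal M cost k → Optimal N cost k
  Optimal-transfer M≤N N≤M ((π , solves , cost≡k) , minimal) =
    (pull N≤M π , solves-pull N≤M π solves , trans (invariant N≤M π) cost≡k) ,
    λ π′ solves′ →
      subst (_ ≤_) (invariant M≤N π′) (minimal (pull M≤N π′) (solves-pull M≤N π′ solves′))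

  Optimal-cong : ∀ {M N} → Reduction M N → Reduction N M → ∀ k → Optimal M cost k ⇔ Optimal N cost k
  Optimal-cong M≤N N≤M k = mk⇔ (Optimal-transfer M≤N N≤M) (Optimal-transfer N≤M M≤N)

-- The hazard derivative at a zero of f

module HazardDerivative {n} (f : Vec Bool n → Bool) (x : Vec Bool n) (fx≡false : f x ≡ false) where

  ¬ConstantOn-true : ∀ y → ¬ ConstantOn f true (x +u y)
  ¬ConstantOn-true y c with trans (sym fx≡false) (c x (+u-≼-self x y))
  ... | ()

  ∂-true⁺ : ∀ y → Attains f true (x +u y) → ∂ f x y ≡ true
  ∂-true⁺ y attains rewrite tilde-𝕦⁺ f (x +u y) attains (x , +u-≼-self x y , fx≡false) = refl

  ∂-true⁻ : ∀ y → ∂ f x y ≡ true → Attains f true (x +u y)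
  ∂-true⁻ y ∂≡true with tilde f (x +u y) | tilde-spec f (x +u y)
  ∂-true⁻ y () | .𝟘 | constant₀ _
  ... | .𝟙 | constant₁ c = ⊥-elim (¬ConstantOn-true y c)
  ... | .𝕦 | mixed attains _ = attains

  ∂-false⁺ : ∀ y → ConstantOn f false (x +u y) → ∂ f x y ≡ false
  ∂-false⁺ y c rewrite tilde-embed⁺ f (x +u y) false c = refl

  ∂-false⁻ : ∀ y → ∂ f x y ≡ false → ConstantOn f false (x +u y)
  ∂-false⁻ y ∂≡false with tilde f (x +u y) | tilde-spec f (x +u y)
  ... | .𝟘 | constant₀ c = c
  ... | .𝟙 | constant₁ c = ⊥-elim (¬ConstantOn-true y c)
  ∂-false⁻ y () | .𝕦 | mixed _ _

  noFlip-implicate : ∀ p → p ⪯ map embed x → tilde f p ≡ 𝟘 → tilde (∂ f x) (map noFlip p) ≡ 𝟘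
  noFlip-implicate p p⪯x tp = tilde-embed⁺ (∂ f x) (map noFlip p) false λ y q≼y →
    ∂-false⁺ y λ z x+uy≼z → tilde-embed⁻ f p false tp z (pointwise λ i →
      ⪯T-noFlip (at (⪯-embed⇒≼ p x p⪯x) i)
                (subst (_⪯T embed (lookup y i)) (lookup-map i noFlip p) (at q≼y i))
                (+u-≼⁻ x y z x+uy≼z i))

  implicate-to-∂ : P₀∣ f x → P₀ (∂ f x)
  implicate-to-∂ (p , (tp , prime) , p⪯x) = q , tq , prime′
    where
    q : Vec Tern n
    q = map noFlip p

    tq : tilde (∂ f x) q ≡ 𝟘
    tq = noFlip-implicate p p⪯x tp

    q≼zeros : q ≼ replicate n false
    q≼zeros = pointwise λ j → subst₂ _⪯T_ (sym (lookup-map j noFlip p))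
      (cong embed (sym (lookup-replicate j false))) (noFlip-⪯𝟘 (lookup p j))

    prime′ : ∀ i → Stable (lookup q i) → tilde (∂ f x) (q [ i ]≔ 𝕦) ≡ 𝕦
    prime′ i st with tilde-𝕦⁻ f (p [ i ]≔ 𝕦)
                       (prime i (noFlip-stable (subst Stable (lookup-map i noFlip p) st)))
    ... | (z , p′≼z , fz) , _ = tilde-𝕦⁺ (∂ f x) (q [ i ]≔ 𝕦)
      (zipWith _xor_ z x , ≼-[]≔𝕦 q _ i flips , ∂-true⁺ _ (z , +u-xor-≼ x z , fz))
      (replicate n false , ≼-antimono (q [ i ]≔ 𝕦) q ([]≔𝕦-⪯ q i) q≼zeros ,
        tilde-embed⁻ (∂ f x) q false tq _ q≼zeros)
      where
      flips : ∀ j → j ≢ i → lookup q j ⪯T embed (lookup (zipWith _xor_ z x) j)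
      flips j j≢i =
        subst₂ _⪯T_ (sym (lookup-map j noFlip p)) (cong embed (sym (lookup-zipWith _xor_ j z x)))
          (noFlip-⪯-xor (at (⪯-embed⇒≼ p x p⪯x) j) (≼-[]≔𝕦⁻ p z p′≼z j≢i))

  mustFlip-implicant : ∀ p → tilde f p ≡ 𝟙 → tilde (∂ f x) (zipWith mustFlip p x) ≡ 𝟙
  mustFlip-implicant p tp = tilde-embed⁺ (∂ f x) _ true λ y q≼y → ∂-true⁺ y
    (complete p x , +u-≼⁺ x y _ (agree y q≼y) , tilde-embed⁻ f p true tp _ (≼-complete p x))
    where
    agree : ∀ y → zipWith mustFlip p x ≼ y →
            ∀ i → lookup y i ≡ false → lookup (complete p x) i ≡ lookup x i
    agree y q≼y i yᵢ = trans (lookup-zipWith fill i p x)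
      (fill-mustFlip (lookup p i) (subst (_⪯T _) (lookup-zipWith mustFlip i p x) (at q≼y i)) yᵢ)

  mustFlip-prime : (a : P₁ f) → PrimeBelow 𝟙 (∂ f x) (zipWith mustFlip (proj₁ a) x)
  mustFlip-prime (p , tp , _) = prime-below (∂ f x) true _ (mustFlip-implicant p tp)

  implicant-to-∂ : P₁ f → P₁ (∂ f x)
  implicant-to-∂ a = prime , isPrime where open PrimeBelow (mustFlip-prime a)

  Mx≤Mu∂ : Reduction (Mx f x) (Mu (∂ f x))
  Mx≤Mu∂ = record { row = implicant-to-∂ ; col = implicate-to-∂ ; out = id ; sound = sound }
    where
    sound : ∀ (a : P₁ f) (b : P₀∣ f x) d →
            Conflict (lookup (proj₁ (implicant-to-∂ a)) d) (lookup (proj₁ (implicate-to-∂ b)) d) →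
            Conflict (lookup (proj₁ a) d) (lookup (proj₁ b) d)
    sound a (p₀ , _ , p₀⪯x) d conflict = conflict-mustFlip
      (subst (λ t → Conflict t _) (lookup-zipWith mustFlip d (proj₁ a) x)
        (Conflict-⪯ˡ (prime⪯ d) (subst (Conflict _) (lookup-map d noFlip p₀) conflict)))
      (at (⪯-embed⇒≼ p₀ x p₀⪯x) d)
      where open PrimeBelow (mustFlip-prime a)

  lookup-unflipped : ∀ q i →
                     lookup (x +u complete q (replicate n true)) i ≡ unflipped (lookup q i) (lookup x i)
  lookup-unflipped q i =
    trans (lookup-+u x _ i) (cong (if_then 𝕦 else _) (lookup-complete-replicate q true i))

  implicate-from-∂ : P₀ (∂ f x) → P₀∣ f x
  implicate-from-∂ (q , tq , prime) = x +u ŷ , (tp , prime′) , +u-⪯ x ŷ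
    where
    ŷ : Vec Bool n
    ŷ = complete q (replicate n true)

    tp : tilde f (x +u ŷ) ≡ 𝟘
    tp = tilde-embed⁺ f _ false (∂-false⁻ ŷ (tilde-embed⁻ (∂ f x) q false tq ŷ (≼-complete q _)))

    prime′ : ∀ i → Stable (lookup (x +u ŷ) i) → tilde f ((x +u ŷ) [ i ]≔ 𝕦) ≡ 𝕦
    prime′ i st with tilde-𝕦⁻ (∂ f x) (q [ i ]≔ 𝕦)
                       (prime i (inj₁ (unflipped-stable (subst Stable (lookup-unflipped q i) st))))
    ... | (y₁ , q′≼y₁ , ∂y₁) , _ with ∂-true⁻ y₁ ∂y₁
    ...   | z , x+uy₁≼z , fz = tilde-𝕦⁺ f ((x +u ŷ) [ i ]≔ 𝕦)
      (z , ≼-[]≔𝕦 (x +u ŷ) z i agree , fz)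
      (x , ≼-antimono ((x +u ŷ) [ i ]≔ 𝕦) (x +u ŷ) ([]≔𝕦-⪯ (x +u ŷ) i) (+u-≼-self x ŷ) ,
        fx≡false)
      where
      agree : ∀ j → j ≢ i → lookup (x +u ŷ) j ⪯T embed (lookup z j)
      agree j j≢i = subst (_⪯T _) (sym (lookup-unflipped q j))
        (unflipped-⪯ (lookup q j) (≼-[]≔𝕦⁻ q y₁ q′≼y₁ j≢i) (+u-≼⁻ x y₁ z x+uy₁≼z j))

  implicant-witness : (a : P₁ (∂ f x)) → Attains f true (x +u complete (proj₁ a) (replicate n false))
  implicant-witness (q , tq , _) = ∂-true⁻ _ (tilde-embed⁻ (∂ f x) q true tq _ (≼-complete q _))

  witness-prime : (a : P₁ (∂ f x)) → PrimeBelow 𝟙 f (map embed (proj₁ (implicant-witness a)))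
  witness-prime a with implicant-witness a
  ... | z , _ , fz = prime-below f true _ (tilde-embed⁺ f _ true λ y z≼y →
    subst (λ v → f v ≡ true) (sym (embed-≼⇒≡ z y z≼y)) fz)

  implicant-from-∂ : P₁ (∂ f x) → P₁ f
  implicant-from-∂ a = prime , isPrime where open PrimeBelow (witness-prime a)

  Mu∂≤Mx : Reduction (Mu (∂ f x)) (Mx f x)
  Mu∂≤Mx = record { row = implicant-from-∂ ; col = implicate-from-∂ ; out = id ; sound = sound }
    where
    sound : ∀ (a : P₁ (∂ f x)) (b : P₀ (∂ f x)) d →
            Conflict (lookup (proj₁ (implicant-from-∂ a)) d) (lookup (proj₁ (implicate-from-∂ b)) d) →
            Conflict (lookup (proj₁ a) d) (lookup (proj₁ b) d)
    sound a@(q , _) (q₀ , _) d conflict = conflict-unflipped (lookup q d) (lookup q₀ d)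
      (subst₂ Conflict (lookup-map d embed z) (lookup-unflipped q₀ d) (Conflict-⪯ˡ (prime⪯ d) conflict))
      (λ ŷᵈ → +u-≼⁻ x _ z x+uŷ≼z d (trans (lookup-complete-replicate q false d) ŷᵈ))
      where
      open PrimeBelow (witness-prime a)

      z : Vec Bool n
      z = proj₁ (implicant-witness a)

      x+uŷ≼z : x +u complete q (replicate n false) ≼ z
      x+uŷ≼z = proj₁ (proj₂ (implicant-witness a))

proposition3p13 : ∀ {n} (f : Vec Bool n → Bool) (x : Vec Bool n) → f x ≡ false →
    (∀ k → IsL (Mx f x) k ⇔ IsL (Mu (∂ f x)) k)
    × (∀ k → IsCC (Mx f x) k ⇔ IsCC (Mu (∂ f x)) k)
proposition3p13 f x fx≡false =
  Optimal-cong leaves leaves-pull Mx≤Mu∂ Mu∂≤Mx ,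
  Optimal-cong depth depth-pull Mx≤Mu∂ Mu∂≤Mx
  where open HazardDerivative f x fx≡false
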